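{- For every formula $A$ of the language of classical propositional logic (i.e., built from $\bot$ and atomic propositions by $\to$, without any subformula of the form $t:B$), $\vdash_{\mathsf{SE}} A$ if and only if $\vdash_{\mathsf{CL}} A$.
   Context: Syntax of $\mathsf{SE}$. There are countably infinite sets of justification constants $\mathsf{JConst}=\{0,1,c_1,c_2,\dots\}$ and justification variables $\mathsf{JVar}$. Terms: constants, variables, and $s\cdot t$, $s+t$ for terms $s,t$. Formulas: $\bot$, atomic propositions $P\in\mathsf{Prop}$, $A\to B$, and $t:A$; $\neg,\wedge,\vee,\leftrightarrow$ are abbreviations. $A[w/t]$ is simultaneous replacement of the variable $w$ by term $t$. Axioms of $\mathsf{SE}$ (for arbitrary formulas $A,B$ and variables $w,x,y,z$): (CL) propositional tautologies; (j) $x:(A\to B)\to(y:A\to x\cdot y:B)$; (j+) $x:A\wedge y:A\to(x+y):A$; (a+) $A[w/(x+y)+z]\to A[w/x+(y+z)]$; (c+) $A[w/x+y]\to A[w/y+x]$; (0+) $A[w/x+0]\leftrightarrow A[w/x]$; (am) $A[w/(x\cdot y)\cdot z]\leftrightarrow A[w/x\cdot(y\cdot z)]$; (a0) $A[w/x\cdot 0]\leftrightarrow A[w/0]$, $A[w/0\cdot x]\leftrightarrow A[w/0]$; (a1) $A[w/x\cdot 1]\leftrightarrow A[w/x]$, $A[w/1\cdot x]\leftrightarrow A[w/x]$; (dl) $A[w/x\cdot(y+z)]\leftrightarrow A[w/x\cdot y+x\cdot z]$; (dr) $A[w/(y+z)\cdot x]\leftrightarrow A[w/y\cdot x+z\cdot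 x]$. Rules: modus ponens and (jv): from $A$ infer $A[x/t]$. $\vdash_{\mathsf{SE}}F$ means $F$ is derivable from the axioms by these rules. $\vdash_{\mathsf{CL}}$ denotes derivability in classical propositional logic. -}

module Defs where

open import Data.Nat using (ℕ)
open import Data.Bool using (Bool; true; false; if_then_else_)
open import Relation.Binary.PropositionalEquality using (_≡_)
open import Relation.Nullary using (Dec; yes; no)
open import Data.Nat using (_≟_)

data JConst : Set where
  c0 : JConst
  c1 : JConst
  c  : ℕ → JConst

JVar : Set
JVar = ℕ

PropVar : Set
PropVar = ℕ

infixl 7 _·_
infixl 6 _⊕_
data Term : Set where
  con  : JConst → Term
  var  : JVar → Term
  _·_  : Term → Term → Term
  _⊕_  : Term → Term → Term

infixr 4 _⇒_
infix 5 _∶_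
data Fm : Set where
  ⊥'   : Fm
  atom : PropVar → Fm
  _⇒_  : Fm → Fm → Fm
  _∶_  : Term → Fm → Fm

¬' : Fm → Fm
¬' A = A ⇒ ⊥'

_∧'_ : Fm → Fm → Fm
A ∧' B = ¬' (A ⇒ ¬' B)

_⇔'_ : Fm → Fm → Fm
A ⇔' B = (A ⇒ B) ∧' (B ⇒ A)

substT : JVar → Term → Term → Term
substT w t (con k) = con k
substT w t (var x) with x ≟ w
... | yes _ = t
... | no  _ = var x
substT w t (s · u) = substT w t s · substT w t u
substT w t (s ⊕ u) = substT w t s ⊕ substT w t u

_[_/_] : Fm → JVar → Term → Fm
⊥' [ w / t ] = ⊥'
atom p [ w / t ] = atom p
(A ⇒ B) [ w / t ] = (A [ w / t ]) ⇒ (B [ w / t ])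
(s ∶ A) [ w / t ] = substT w t s ∶ (A [ w / t ])

-- Boolean evaluation, treating atoms and justification formulas t:B as
-- independent propositional letters.
⟦_⟧ : Fm → (PropVar → Bool) → (Term → Fm → Bool) → Bool
⟦ ⊥' ⟧ v j = false
⟦ atom p ⟧ v j = v p
⟦ A ⇒ B ⟧ v j = if ⟦ A ⟧ v j then ⟦ B ⟧ v j else true
⟦ t ∶ A ⟧ v j = j t A

Tautology : Fm → Set
Tautology A = ∀ (v : PropVar → Bool) (j : Term → Fm → Bool) → ⟦ A ⟧ v j ≡ true

data IsCL : Fm → Set where
  ⊥-cl    : IsCL ⊥'
  atom-cl : ∀ p → IsCL (atom p)
  ⇒-cl    : ∀ {A B} → IsCL A → IsCL B → IsCL (A ⇒ B)

zero one : Term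
zero = con c0
one  = con c1

data AxSE : Fm → Set where
  ax-CL  : ∀ {A} → Tautology A → AxSE A
  ax-j   : ∀ (A B : Fm) (x y : JVar) →
           AxSE ((var x ∶ (A ⇒ B)) ⇒ ((var y ∶ A) ⇒ (var x · var y ∶ B)))
  ax-j+  : ∀ (A : Fm) (x y : JVar) →
           AxSE (((var x ∶ A) ∧' (var y ∶ A)) ⇒ (var x ⊕ var y ∶ A))
  ax-a+  : ∀ (A : Fm) (w x y z : JVar) →
           AxSE ((A [ w / (var x ⊕ var y) ⊕ var z ]) ⇒ (A [ w / var x ⊕ (var y ⊕ var z) ]))
  ax-c+  : ∀ (A : Fm) (w x y : JVar) →
           AxSE ((A [ w / var x ⊕ var y ]) ⇒ (A [ w / var y ⊕ var x ]))
  ax-0+  : ∀ (A : Fm) (w x : JVar) →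
           AxSE ((A [ w / var x ⊕ zero ]) ⇔' (A [ w / var x ]))
  ax-am  : ∀ (A : Fm) (w x y z : JVar) →
           AxSE ((A [ w / (var x · var y) · var z ]) ⇔' (A [ w / var x · (var y · var z) ]))
  ax-a0r : ∀ (A : Fm) (w x : JVar) →
           AxSE ((A [ w / var x · zero ]) ⇔' (A [ w / zero ]))
  ax-a0l : ∀ (A : Fm) (w x : JVar) →
           AxSE ((A [ w / zero · var x ]) ⇔' (A [ w / zero ]))
  ax-a1r : ∀ (A : Fm) (w x : JVar) →
           AxSE ((A [ w / var x · one ]) ⇔' (A [ w / var x ]))
  ax-a1l : ∀ (A : Fm) (w x : JVar) →
           AxSE ((A [ w / one · var x ]) ⇔' (A [ w / var x ]))
  ax-dl  : ∀ (A : Fm) (w x y z : JVar) →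
           AxSE ((A [ w / var x · (var y ⊕ var z) ]) ⇔' (A [ w / var x · var y ⊕ var x · var z ]))
  ax-dr  : ∀ (A : Fm) (w x y z : JVar) →
           AxSE ((A [ w / (var y ⊕ var z) · var x ]) ⇔' (A [ w / var y · var x ⊕ var z · var x ]))

data ⊢SE : Fm → Set where
  ax : ∀ {A} → AxSE A → ⊢SE A
  mp : ∀ {A B} → ⊢SE (A ⇒ B) → ⊢SE A → ⊢SE B
  jv : ∀ {A} (x : JVar) (t : Term) → ⊢SE A → ⊢SE (A [ x / t ])

data ⊢CL : Fm → Set where
  ax : ∀ {A} → IsCL A → Tautology A → ⊢CL A
  mp : ∀ {A B} → ⊢CL (A ⇒ B) → ⊢CL A → ⊢CL B

-- Soundness: giving every justification formula t:B one fixed truth value turns each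
-- axiom of SE into a tautology (the substitution axioms only change terms,
-- which are then invisible) and is preserved by modus ponens and (jv); on a
-- formula without justifications this reading is ordinary Boolean evaluation.
-- Completeness: CL-tautologies are axioms of SE and both systems have modus ponens.
module Submission where

open import Defs
open import Data.Bool using (Bool; true; false; if_then_else_)
open import Data.Product using (_×_; _,_)
open import Relation.Binary.PropositionalEquality using (_≡_; refl; trans; cong₂)

constJ : Bool → Term → Fm → Bool
constJ b _ _ = b

⟦⟧-subst-constJ : ∀ A w t v b → ⟦ A [ w / t ] ⟧ v (constJ b) ≡ ⟦ A ⟧ v (constJ b)
⟦⟧-subst-constJ ⊥'       w t v b = refl
⟦⟧-subst-constJ (atom p) w t v b = refl
⟦⟧-subst-constJ (A ⇒ B)  w t v b =
  cong₂ (λ x y → if x then y else true) (⟦⟧-subst-constJ A w t v b) (⟦⟧-subst-constJ B w t v b)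
⟦⟧-subst-constJ (s ∶ A)  w t v b = refl

⟦⇒⟧-refl : ∀ A v j → ⟦ A ⇒ A ⟧ v j ≡ true
⟦⇒⟧-refl A v j with ⟦ A ⟧ v j
... | true  = refl
... | false = refl

⟦⇔⟧-refl : ∀ A v j → ⟦ A ⇔' A ⟧ v j ≡ true
⟦⇔⟧-refl A v j with ⟦ A ⟧ v j
... | true  = refl
... | false = refl

⟦⟧-mp : ∀ A B v j → ⟦ A ⇒ B ⟧ v j ≡ true → ⟦ A ⟧ v j ≡ true → ⟦ B ⟧ v j ≡ true
⟦⟧-mp A B v j A⇒B-true A-true with ⟦ A ⟧ v j
⟦⟧-mp A B v j A⇒B-true refl | true = A⇒B-true

⟦⟧-subst-⇒-constJ : ∀ A w s u v b → ⟦ (A [ w / s ]) ⇒ (A [ w / u ]) ⟧ v (constJ b) ≡ true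
⟦⟧-subst-⇒-constJ A w s u v b
  rewrite ⟦⟧-subst-constJ A w s v b | ⟦⟧-subst-constJ A w u v b = ⟦⇒⟧-refl A v (constJ b)

⟦⟧-subst-⇔-constJ : ∀ A w s u v b → ⟦ (A [ w / s ]) ⇔' (A [ w / u ]) ⟧ v (constJ b) ≡ true
⟦⟧-subst-⇔-constJ A w s u v b
  rewrite ⟦⟧-subst-constJ A w s v b | ⟦⟧-subst-constJ A w u v b = ⟦⇔⟧-refl A v (constJ b)

AxSE-sound-constJ : ∀ {A} → AxSE A → ∀ v b → ⟦ A ⟧ v (constJ b) ≡ true
AxSE-sound-constJ (ax-CL taut)       v b     = taut v (constJ b)
AxSE-sound-constJ (ax-j A B x y)     v true  = refl
AxSE-sound-constJ (ax-j A B x y)     v false = refl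
AxSE-sound-constJ (ax-j+ A x y)      v true  = refl
AxSE-sound-constJ (ax-j+ A x y)      v false = refl
AxSE-sound-constJ (ax-a+ A w x y z)  v b     = ⟦⟧-subst-⇒-constJ A w _ _ v b
AxSE-sound-constJ (ax-c+ A w x y)    v b     = ⟦⟧-subst-⇒-constJ A w _ _ v b
AxSE-sound-constJ (ax-0+ A w x)      v b     = ⟦⟧-subst-⇔-constJ A w _ _ v b
AxSE-sound-constJ (ax-am A w x y z)  v b     = ⟦⟧-subst-⇔-constJ A w _ _ v b
AxSE-sound-constJ (ax-a0r A w x)     v b     = ⟦⟧-subst-⇔-constJ A w _ _ v b
AxSE-sound-constJ (ax-a0l A w x)     v b     = ⟦⟧-subst-⇔-constJ A w _ _ v b
AxSE-sound-constJ (ax-a1r A w x)     v b     = ⟦⟧-subst-⇔-constJ A w _ _ v b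
AxSE-sound-constJ (ax-a1l A w x)     v b     = ⟦⟧-subst-⇔-constJ A w _ _ v b
AxSE-sound-constJ (ax-dl A w x y z)  v b     = ⟦⟧-subst-⇔-constJ A w _ _ v b
AxSE-sound-constJ (ax-dr A w x y z)  v b     = ⟦⟧-subst-⇔-constJ A w _ _ v b

⊢SE-sound-constJ : ∀ {A} → ⊢SE A → ∀ v b → ⟦ A ⟧ v (constJ b) ≡ true
⊢SE-sound-constJ (ax a)           v b = AxSE-sound-constJ a v b
⊢SE-sound-constJ (mp {A} {B} d e) v b =
  ⟦⟧-mp A B v (constJ b) (⊢SE-sound-constJ d v b) (⊢SE-sound-constJ e v b)
⊢SE-sound-constJ (jv {A} x t d)   v b = trans (⟦⟧-subst-constJ A x t v b) (⊢SE-sound-constJ d v b)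

IsCL⇒⟦⟧-indep-j : ∀ {A} → IsCL A → ∀ v j j′ → ⟦ A ⟧ v j ≡ ⟦ A ⟧ v j′
IsCL⇒⟦⟧-indep-j ⊥-cl        v j j′ = refl
IsCL⇒⟦⟧-indep-j (atom-cl p) v j j′ = refl
IsCL⇒⟦⟧-indep-j (⇒-cl a b)  v j j′ =
  cong₂ (λ x y → if x then y else true) (IsCL⇒⟦⟧-indep-j a v j j′) (IsCL⇒⟦⟧-indep-j b v j j′)

⊢SE∧IsCL⇒Tautology : ∀ {A} → IsCL A → ⊢SE A → Tautology A
⊢SE∧IsCL⇒Tautology cl d v j = trans (IsCL⇒⟦⟧-indep-j cl v j (constJ true)) (⊢SE-sound-constJ d v true)

⊢CL⇒⊢SE : ∀ {A} → ⊢CL A → ⊢SE A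
⊢CL⇒⊢SE (ax _ taut) = ax (ax-CL taut)
⊢CL⇒⊢SE (mp d e)    = mp (⊢CL⇒⊢SE d) (⊢CL⇒⊢SE e)

mainTheorem5 : ∀ (A : Fm) → IsCL A → (⊢SE A → ⊢CL A) × (⊢CL A → ⊢SE A)
mainTheorem5 A cl = (λ d → ax cl (⊢SE∧IsCL⇒Tautology cl d)) , ⊢CL⇒⊢SE
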